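{- Let $p,q,n$ be positive integers with $q\ge p\ge 2$ and $n\ge p+q+2$. If $p\ge 3$ or $q\ge 4$, then $ex_{\mathcal{OP}}(n,S_{p,q})=2n-3$.
   Context: All graphs are finite, simple and undirected. For integers $q\ge p\ge 1$, the double star $S_{p,q}$ is the graph obtained from an edge $xy$ by joining $x$ to $p$ new vertices and $y$ to $q$ further new vertices. A graph is $H$-free if it contains no subgraph isomorphic to $H$. A graph is outerplanar if it has a planar embedding with all vertices on the boundary of the outer face. $ex_{\mathcal{OP}}(n,H)$ denotes the maximum number of edges of an $H$-free outerplanar graph on $n$ vertices. -}

module Defs where

open import Data.Nat using (ℕ; zero; suc; _+_; _*_; _<ᵇ_; _≤ᵇ_; _≡ᵇ_)
open import Data.Bool using (Bool; true; false; _∧_; _∨_; if_then_else_)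
open import Data.Fin using (Fin; toℕ; _<_)
open import Data.List using (List; map; allFin)
open import Data.Nat.ListAction using (sum)
open import Data.Product using (Σ; _×_)
open import Relation.Binary.PropositionalEquality using (_≡_; refl; cong)
open import Relation.Nullary using (¬_)
open import Data.Bool.Properties using (∨-comm)
open import Function.Definitions using (Injective)

record Graph (n : ℕ) : Set where
  field
    adj   : Fin n → Fin n → Bool
    sym   : ∀ i j → adj i j ≡ adj j i
    irrefl : ∀ i → adj i i ≡ false
open Graph public

edgeCount : ∀ {n} → Graph n → ℕ
edgeCount {n} G =
  sum (map (λ i → sum (map (λ j →
         if (toℕ i <ᵇ toℕ j) ∧ adj G i j then 1 else 0)
       (allFin n))) (allFin n))

Contains : ∀ {n m} → Graph n → Graph m → Set
Contains {n} {m} G H =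
  Σ (Fin m → Fin n) λ f →
    Injective _≡_ _≡_ f × (∀ i j → adj H i j ≡ true → adj G (f i) (f j) ≡ true)

_-free : ∀ {n m} → Graph n → Graph m → Set
_-free G H = ¬ Contains G H

-- Outerplanar: the vertices can be placed (injectively) in cyclic order
-- on a circle so that no two edges, drawn as chords, cross.
-- Chords ab and cd cross iff, in the linear order pos, pos a < pos c < pos b < pos d
-- (for a suitable labelling of their endpoints).
Outerplanar : ∀ {n} → Graph n → Set
Outerplanar {n} G =
  Σ (Fin n → Fin n) λ pos →
    Injective _≡_ _≡_ pos ×
    (∀ a b c d → adj G a b ≡ true → adj G c d ≡ true →
       ¬ (pos a < pos c × pos c < pos b × pos b < pos d))

-- Double star S_{p,q} on vertices Fin (2 + p + q):
-- vertex 0 = x, vertex 1 = y, vertices 2 .. p+1 are the p leaves of x,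
-- vertices p+2 .. p+q+1 are the q leaves of y.
dsAdjℕ : ℕ → ℕ → ℕ → Bool
dsAdjℕ p i j =
     ((i ≡ᵇ 0) ∧ (j ≡ᵇ 1))
  ∨ ((i ≡ᵇ 0) ∧ (2 ≤ᵇ j) ∧ (j <ᵇ 2 + p))
  ∨ ((i ≡ᵇ 1) ∧ (2 + p ≤ᵇ j))

dsAdj : ℕ → ℕ → ℕ → Bool
dsAdj p i j = dsAdjℕ p i j ∨ dsAdjℕ p j i

dsAdjℕ-irrefl : ∀ p i → dsAdjℕ p i i ≡ false
dsAdjℕ-irrefl p zero = refl
dsAdjℕ-irrefl p (suc zero) = refl
dsAdjℕ-irrefl p (suc (suc i)) = refl

DoubleStar : (p q : ℕ) → Graph (2 + p + q)
DoubleStar p q = record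
  { adj = λ i j → dsAdj p (toℕ i) (toℕ j)
  ; sym = λ i j → ∨-comm (dsAdjℕ p (toℕ i) (toℕ j)) (dsAdjℕ p (toℕ j) (toℕ i))
  ; irrefl = λ i → cong (λ b → b ∨ b) (dsAdjℕ-irrefl p (toℕ i))
  }

{-# OPTIONS --safe #-}
module Submission where

-- Upper bound: list the vertices in their order on the circle and charge every edge to one of its
-- ends.  Because no two edges cross, this can be done so that every vertex takes at most one
-- charge from the left and one from the right, and three of these 2n charges are always missing.
--
-- Lower bound: the square of the path 0 − 1 − ⋯ − (n − 1), where i ~ j iff 1 ≤ |i − j| ≤ 2, has
-- 2n − 3 edges and a zigzag outerplanar drawing.  Its maximum degree is 4 and every edge xy lies
-- on a triangle xyc.  An S_{p,q} with q ≥ 4 would need a vertex of degree 5.  With p, q ≥ 3 the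
-- vertices x and y of the star already have four neighbours each, so c is a neighbour of x and a
-- neighbour of y in the star; but these neighbourhoods are disjoint.

open import Defs hiding (sym; irrefl)

open import Data.Bool using (Bool; true; false; _∧_; _∨_; not; if_then_else_; T)
open import Data.Bool.Properties using (∧-zeroʳ) renaming (_≟_ to _≟ᵇ_)
open import Data.Empty using (⊥)
open import Data.Fin as Fin using (Fin; zero; suc; toℕ; fromℕ<; _↑ˡ_; _↑ʳ_; inject≤; punchIn; punchOut; splitAt)
import Data.Fin.Properties as Finₚ
open import Data.List using (map; allFin; tabulate)
open import Data.List.Extrema.Nat using (argmin; argmax; f[argmin]≤f[xs]; f[xs]≤f[argmax])
open import Data.List.Membership.Propositional.Properties using (∈-allFin)
open import Data.List.Properties using (map-tabulate)
import Data.List.Relation.Unary.All as All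
open import Data.Nat using (ℕ; zero; suc; _+_; _*_; _∸_; _⊓_; _≤_; _<_; _<ᵇ_; _≤ᵇ_; ⌊_/2⌋; ⌈_/2⌉; ∣_-_∣; z≤n; s≤s)
import Data.Nat.ListAction as ListAction
open import Data.Nat.Properties
open import Data.Product using (Σ; ∃; ∃₂; _×_; _,_; proj₁; proj₂)
open import Data.Sum using (_⊎_; inj₁; inj₂; map₁)
open import Data.Unit using (tt)
open import Data.Vec.Functional using (removeAt; _∷_)
open import Function using (_∘_; id)
open import Function.Definitions using (Injective)
open import Relation.Binary.Definitions using (tri<; tri≈; tri>)
open import Relation.Binary.PropositionalEquality
  using (_≡_; _≢_; refl; sym; trans; cong; cong₂; subst; subst₂; module ≡-Reasoning)
open import Relation.Nullary using (¬_; Dec; yes; no; does; contradiction)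
open import Relation.Nullary.Decidable using (dec-true; dec-false; _×-dec_; ¬?)

open import Algebra.Properties.CommutativeSemigroup +-commutativeSemigroup using (interchange)
open import Algebra.Properties.CommutativeMonoid.Sum +-0-commutativeMonoid
  using (sum; sum-syntax; sum-cong-≗; sum-replicate-zero; sum-remove; ∑-distrib-+; ∑-comm)

𝟙 : Bool → ℕ
𝟙 b = if b then 1 else 0

<ᵇ-true : ∀ {m n} → m < n → (m <ᵇ n) ≡ true
<ᵇ-true {m} {n} = dec-true (m <? n)

<ᵇ-false : ∀ {m n} → ¬ m < n → (m <ᵇ n) ≡ false
<ᵇ-false {m} {n} = dec-false (m <? n)

≤ᵇ-true : ∀ {m n} → m ≤ n → (m ≤ᵇ n) ≡ true
≤ᵇ-true {m} {n} = dec-true (m ≤? n)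

<ᵇ-sound : ∀ {m n} → (m <ᵇ n) ≡ true → m < n
<ᵇ-sound {m} {n} m<ᵇn = <ᵇ⇒< m n (subst T (sym m<ᵇn) tt)

∧-true : ∀ {b c} → b ∧ c ≡ true → b ≡ true × c ≡ true
∧-true {true} {true} _ = refl , refl

∨-true : ∀ {b} c → b ≡ true → b ∨ c ≡ true
∨-true c refl = refl

2[2+m]∸3≡m+[1+m] : ∀ m → 2 * (2 + m) ∸ 3 ≡ m + suc m
2[2+m]∸3≡m+[1+m] m = begin
  2 * (2 + m) ∸ 3    ≡⟨ cong (_∸ 3) (*-distribˡ-+ 2 2 m) ⟩
  suc (m + (m + 0))  ≡⟨ cong (λ k → suc (m + k)) (+-identityʳ m) ⟩
  suc (m + m)        ≡⟨ +-suc m m ⟨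
  m + suc m          ∎
  where open ≡-Reasoning

∑-zero : ∀ {n} {f : Fin n → ℕ} → (∀ i → f i ≡ 0) → sum f ≡ 0
∑-zero {n} f≡0 = trans (sum-cong-≗ f≡0) (sum-replicate-zero n)

∑-mono-≤ : ∀ {n} {f g : Fin n → ℕ} → (∀ i → f i ≤ g i) → sum f ≤ sum g
∑-mono-≤ {zero}  f≤g = z≤n
∑-mono-≤ {suc n} f≤g = +-mono-≤ (f≤g zero) (∑-mono-≤ (f≤g ∘ suc))

∑≤1⇒≤ : ∀ {n} {f : Fin n → ℕ} → (∀ i → f i ≤ 1) → sum f ≤ n
∑≤1⇒≤ {zero}  f≤1 = z≤n
∑≤1⇒≤ {suc n} f≤1 = +-mono-≤ (f≤1 zero) (∑≤1⇒≤ (f≤1 ∘ suc))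

∑≤1-vanishing : ∀ {n} {f : Fin (suc n) → ℕ} {a} → (∀ i → f i ≤ 1) → f a ≡ 0 → sum f ≤ n
∑≤1-vanishing {n} {f} {a} f≤1 fa≡0 = begin
  sum f                     ≡⟨ sum-remove {i = a} f ⟩
  f a + sum (removeAt f a)  ≡⟨ cong (_+ sum (removeAt f a)) fa≡0 ⟩
  sum (removeAt f a)        ≤⟨ ∑≤1⇒≤ (f≤1 ∘ punchIn a) ⟩
  n                         ∎
  where open ≤-Reasoning

∑≤1-vanishing₂ : ∀ {n} {f : Fin (suc (suc n)) → ℕ} {a b} → a ≢ b →
                 (∀ i → f i ≤ 1) → f a ≡ 0 → f b ≡ 0 → sum f ≤ n
∑≤1-vanishing₂ {n} {f} {a} {b} a≢b f≤1 fa≡0 fb≡0 = begin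
  sum f                     ≡⟨ sum-remove {i = a} f ⟩
  f a + sum (removeAt f a)  ≡⟨ cong (_+ sum (removeAt f a)) fa≡0 ⟩
  sum (removeAt f a)        ≤⟨ ∑≤1-vanishing (f≤1 ∘ punchIn a) f[b]≡0 ⟩
  n                         ∎
  where
  open ≤-Reasoning
  f[b]≡0 : removeAt f a (punchOut a≢b) ≡ 0
  f[b]≡0 = trans (cong f (Finₚ.punchIn-punchOut a≢b)) fb≡0

𝟙-refuted : ∀ {P : Set} (P? : Dec P) → ¬ P → 𝟙 (does P?) ≡ 0
𝟙-refuted P? ¬P = cong 𝟙 (dec-false P? ¬P)

∑-𝟙-unique≤1 : ∀ {n} {P : Fin n → Set} (P? : ∀ i → Dec (P i)) →
               (∀ {i j} → P i → P j → i ≡ j) → sum (λ i → 𝟙 (does (P? i))) ≤ 1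
∑-𝟙-unique≤1 {zero}  P? unique = z≤n
∑-𝟙-unique≤1 {suc n} P? unique with P? zero
... | yes P0 = ≤-reflexive (cong suc (∑-zero (λ i → 𝟙-refuted (P? (suc i)) (Finₚ.0≢1+n ∘ unique P0))))
... | no  _  = ∑-𝟙-unique≤1 (P? ∘ suc) (λ Pi Pj → Finₚ.suc-injective (unique Pi Pj))

sum-tabulate : ∀ {n} (f : Fin n → ℕ) → ListAction.sum (tabulate f) ≡ sum f
sum-tabulate {zero}  f = refl
sum-tabulate {suc n} f = cong (f zero +_) (sum-tabulate (f ∘ suc))

sum-map-allFin : ∀ {n} (f : Fin n → ℕ) → ListAction.sum (map f (allFin n)) ≡ sum f
sum-map-allFin f = trans (cong ListAction.sum (map-tabulate id f)) (sum-tabulate f)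

forwardEdgeCount : ∀ {n} → Graph n → (Fin n → ℕ) → ℕ
forwardEdgeCount {n} G K = ∑[ i < n ] ∑[ j < n ] 𝟙 ((K i <ᵇ K j) ∧ adj G i j)

edgeCount≡forwardEdgeCount : ∀ {n} (G : Graph n) → edgeCount G ≡ forwardEdgeCount G toℕ
edgeCount≡forwardEdgeCount {n} G =
  trans (sum-map-allFin (λ i → ListAction.sum (map (f i) (allFin n)))) (sum-cong-≗ (sum-map-allFin ∘ f))
  where
  f : Fin n → Fin n → ℕ
  f i j = 𝟙 ((toℕ i <ᵇ toℕ j) ∧ adj G i j)

module _ {n} (G : Graph n) {K : Fin n → ℕ} (K-injective : Injective _≡_ _≡_ K) where

  𝟙-adj-split : ∀ i j → 𝟙 (adj G i j) ≡ 𝟙 ((K i <ᵇ K j) ∧ adj G i j) + 𝟙 ((K j <ᵇ K i) ∧ adj G j i)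
  𝟙-adj-split i j rewrite Graph.sym G j i with <-cmp (K i) (K j)
  ... | tri< i<j _ j≮i rewrite <ᵇ-true i<j | <ᵇ-false j≮i = sym (+-identityʳ _)
  ... | tri> i≮j _ j<i rewrite <ᵇ-false i≮j | <ᵇ-true j<i = refl
  ... | tri≈ _ Ki≡Kj _ with refl ← K-injective Ki≡Kj
    rewrite Graph.irrefl G i | ∧-zeroʳ (K i <ᵇ K i) = refl

  handshake : ∑[ i < n ] ∑[ j < n ] 𝟙 (adj G i j) ≡ forwardEdgeCount G K + forwardEdgeCount G K
  handshake = begin
    ∑[ i < n ] ∑[ j < n ] 𝟙 (adj G i j)                   ≡⟨ sum-cong-≗ (λ i → sum-cong-≗ (𝟙-adj-split i)) ⟩
    ∑[ i < n ] ∑[ j < n ] (f i j + f j i)                 ≡⟨ sum-cong-≗ (λ i → ∑-distrib-+ (f i) (λ j → f j i)) ⟩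
    ∑[ i < n ] (∑[ j < n ] f i j + ∑[ j < n ] f j i)      ≡⟨ ∑-distrib-+ (λ i → ∑[ j < n ] f i j) (λ i → ∑[ j < n ] f j i) ⟩
    forwardEdgeCount G K + ∑[ i < n ] ∑[ j < n ] f j i    ≡⟨ cong (forwardEdgeCount G K +_) (∑-comm (λ i j → f j i)) ⟩
    forwardEdgeCount G K + forwardEdgeCount G K           ∎
    where
    open ≡-Reasoning
    f : Fin n → Fin n → ℕ
    f i j = 𝟙 ((K i <ᵇ K j) ∧ adj G i j)

+-double-injective : ∀ {m n} → m + m ≡ n + n → m ≡ n
+-double-injective {m} {n} eq = *-cancelˡ-≡ m n 2 (begin
  2 * m        ≡⟨ cong (m +_) (+-identityʳ m) ⟩
  m + m        ≡⟨ eq ⟩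
  n + n        ≡⟨ cong (n +_) (+-identityʳ n) ⟨
  2 * n        ∎)
  where open ≡-Reasoning

forwardEdgeCount-invariant : ∀ {n} (G : Graph n) {K L : Fin n → ℕ} →
  Injective _≡_ _≡_ K → Injective _≡_ _≡_ L → forwardEdgeCount G K ≡ forwardEdgeCount G L
forwardEdgeCount-invariant G K-inj L-inj =
  +-double-injective (trans (sym (handshake G K-inj)) (handshake G L-inj))

-- A forward edge ij (K i < K j) is charged to i when j is the last forward neighbour of i, and
-- otherwise to j; then i is the first backward neighbour of j, for otherwise two edges at i and j
-- cross.  So every vertex takes at most one out-charge and one in-charge.  The first vertex takes
-- no in-charge, the last no out-charge, and either the first vertex takes no out-charge or its
-- last forward neighbour takes no in-charge.
module NonCrossing {m} (G : Graph (2 + m)) (K : Fin (2 + m) → ℕ) (K-injective : Injective _≡_ _≡_ K)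
  (noncrossing : ∀ a b c d → adj G a b ≡ true → adj G c d ≡ true → ¬ (K a < K c × K c < K b × K b < K d))
  where

  V : Set
  V = Fin (2 + m)

  Forward : V → V → Set
  Forward i j = K i < K j × adj G i j ≡ true

  LastOut : V → V → Set
  LastOut i j = Forward i j × ¬ ∃ λ k → Forward i k × K j < K k

  FirstIn : V → V → Set
  FirstIn i j = Forward i j × ¬ ∃ λ k → Forward k j × K k < K i

  ChargedIn : V → V → Set
  ChargedIn i j = FirstIn i j × ¬ LastOut i j

  opaque
    forward? : ∀ i j → Dec (Forward i j)
    forward? i j = (K i <? K j) ×-dec (adj G i j ≟ᵇ true)

    lastOut? : ∀ i j → Dec (LastOut i j)
    lastOut? i j = forward? i j ×-dec ¬? (Finₚ.any? λ k → forward? i k ×-dec (K j <? K k))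

    chargedIn? : ∀ i j → Dec (ChargedIn i j)
    chargedIn? i j = (forward? i j ×-dec ¬? (Finₚ.any? λ k → forward? k j ×-dec (K k <? K i))) ×-dec ¬? (lastOut? i j)

  forward-charged : ∀ {i j} → Forward i j → LastOut i j ⊎ ChargedIn i j
  forward-charged {i} {j} ij with lastOut? i j
  ... | yes last    = inj₁ last
  ... | no  notLast = inj₂ ((ij , first) , notLast)
    where
    first : ¬ ∃ λ k → Forward k j × K k < K i
    first (k , (_ , kj) , k<i) =
      notLast (ij , λ { (l , (_ , il) , j<l) → noncrossing k j i l kj il (k<i , proj₁ ij , j<l) })

  outCharge : V → ℕ
  outCharge i = ∑[ j < 2 + m ] 𝟙 (does (lastOut? i j))

  inCharge : V → ℕ
  inCharge j = ∑[ i < 2 + m ] 𝟙 (does (chargedIn? i j))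

  𝟙-forward≤charges : ∀ i j → 𝟙 ((K i <ᵇ K j) ∧ adj G i j) ≤ 𝟙 (does (lastOut? i j)) + 𝟙 (does (chargedIn? i j))
  𝟙-forward≤charges i j with (K i <ᵇ K j) ∧ adj G i j in ij
  ... | false = z≤n
  ... | true  with forward-charged (<ᵇ-sound (proj₁ (∧-true ij)) , proj₂ (∧-true ij))
  ...   | inj₁ last    rewrite dec-true (lastOut? i j) last = s≤s z≤n
  ...   | inj₂ charged rewrite dec-true (chargedIn? i j) charged = m≤n+m 1 _

  forwardEdgeCount≤charges : forwardEdgeCount G K ≤ sum outCharge + sum inCharge
  forwardEdgeCount≤charges = begin
    forwardEdgeCount G K                                           ≤⟨ ∑-mono-≤ (λ i → ∑-mono-≤ (𝟙-forward≤charges i)) ⟩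
    ∑[ i < 2 + m ] ∑[ j < 2 + m ] (out i j + in′ i j)              ≡⟨ sum-cong-≗ (λ i → ∑-distrib-+ (out i) (in′ i)) ⟩
    ∑[ i < 2 + m ] (outCharge i + ∑[ j < 2 + m ] in′ i j)          ≡⟨ ∑-distrib-+ outCharge (λ i → ∑[ j < 2 + m ] in′ i j) ⟩
    sum outCharge + ∑[ i < 2 + m ] ∑[ j < 2 + m ] in′ i j          ≡⟨ cong (sum outCharge +_) (∑-comm in′) ⟩
    sum outCharge + sum inCharge                                   ∎
    where
    open ≤-Reasoning
    out in′ : V → V → ℕ
    out i j = 𝟙 (does (lastOut? i j))
    in′ i j = 𝟙 (does (chargedIn? i j))

  outCharge≤1 : ∀ i → outCharge i ≤ 1
  outCharge≤1 i = ∑-𝟙-unique≤1 (lastOut? i) unique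
    where
    unique : ∀ {j k} → LastOut i j → LastOut i k → j ≡ k
    unique {j} {k} (ij , ¬j<) (ik , ¬k<) with <-cmp (K j) (K k)
    ... | tri< j<k _ _ = contradiction (k , ik , j<k) ¬j<
    ... | tri≈ _ j≡k _ = K-injective j≡k
    ... | tri> _ _ k<j = contradiction (j , ij , k<j) ¬k<

  inCharge≤1 : ∀ j → inCharge j ≤ 1
  inCharge≤1 j = ∑-𝟙-unique≤1 (λ i → chargedIn? i j) unique
    where
    unique : ∀ {i k} → ChargedIn i j → ChargedIn k j → i ≡ k
    unique {i} {k} ((ij , ¬i<) , _) ((kj , ¬k<) , _) with <-cmp (K i) (K k)
    ... | tri< i<k _ _ = contradiction (i , ij , i<k) ¬k<
    ... | tri≈ _ i≡k _ = K-injective i≡k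
    ... | tri> _ _ k<i = contradiction (k , kj , k<i) ¬i<

  opaque
    first last : V
    first = argmin K zero (allFin _)
    last  = argmax K zero (allFin _)

    first-≤ : ∀ i → K first ≤ K i
    first-≤ i = All.lookup (f[argmin]≤f[xs] {f = K} zero (allFin _)) (∈-allFin i)

    last-≥ : ∀ i → K i ≤ K last
    last-≥ i = All.lookup (f[xs]≤f[argmax] {f = K} zero (allFin _)) (∈-allFin i)

  first≢last : first ≢ last
  first≢last first≡last = Finₚ.0≢1+n (K-injective (≤-antisym (squeeze zero) (squeeze (suc zero))))
    where
    squeeze : ∀ i {j} → K i ≤ K j
    squeeze i {j} = ≤-trans (last-≥ i) (subst (λ k → K k ≤ K j) first≡last (first-≤ j))

  inCharge-first : inCharge first ≡ 0
  inCharge-first = ∑-zero λ i → 𝟙-refuted (chargedIn? i first) λ (((i<first , _) , _) , _) → <⇒≱ i<first (first-≤ i)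

  outCharge-last : outCharge last ≡ 0
  outCharge-last = ∑-zero λ j → 𝟙-refuted (lastOut? last j) λ ((last<j , _) , _) → <⇒≱ last<j (last-≥ j)

  inCharge-lastOut-first : ∀ {j} → LastOut first j → inCharge j ≡ 0
  inCharge-lastOut-first {j} firstj = ∑-zero λ i → 𝟙-refuted (chargedIn? i j) (uncharged i)
    where
    uncharged : ∀ i → ¬ ChargedIn i j
    uncharged i ((ij , notFirst) , notLast) with i Finₚ.≟ first
    ... | yes refl     = notLast firstj
    ... | no  i≢first  = notFirst (first , proj₁ firstj , ≤∧≢⇒< (first-≤ i) (i≢first ∘ sym ∘ K-injective))

  charges≤ : sum outCharge + sum inCharge ≤ m + suc m
  charges≤ with Finₚ.any? (lastOut? first)
  ... | no noLast = +-mono-≤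
          (∑≤1-vanishing₂ first≢last outCharge≤1 (∑-zero λ j → 𝟙-refuted (lastOut? first j) (noLast ∘ (j ,_))) outCharge-last)
          (∑≤1-vanishing inCharge≤1 inCharge-first)
  ... | yes (j , firstj) = subst (sum outCharge + sum inCharge ≤_) (+-comm (suc m) m) (+-mono-≤
          (∑≤1-vanishing outCharge≤1 outCharge-last)
          (∑≤1-vanishing₂ j≢first inCharge≤1 (inCharge-lastOut-first firstj) inCharge-first))
    where
    j≢first : j ≢ first
    j≢first j≡first = <-irrefl (cong K (sym j≡first)) (proj₁ (proj₁ firstj))

  forwardEdgeCount≤ : forwardEdgeCount G K ≤ m + suc m
  forwardEdgeCount≤ = ≤-trans forwardEdgeCount≤charges charges≤

outerplanar-edgeCount≤ : ∀ {n} → 2 ≤ n → (G : Graph n) → Outerplanar G → edgeCount G ≤ 2 * n ∸ 3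
outerplanar-edgeCount≤ {suc (suc m)} (s≤s (s≤s _)) G (pos , pos-injective , noncrossing) = begin
  edgeCount G                  ≡⟨ edgeCount≡forwardEdgeCount G ⟩
  forwardEdgeCount G toℕ       ≡⟨ forwardEdgeCount-invariant G Finₚ.toℕ-injective K-injective ⟩
  forwardEdgeCount G K         ≤⟨ NonCrossing.forwardEdgeCount≤ G K K-injective noncrossing ⟩
  m + suc m                    ≡⟨ 2[2+m]∸3≡m+[1+m] m ⟨
  2 * suc (suc m) ∸ 3          ∎
  where
  open ≤-Reasoning
  K : Fin (suc (suc m)) → ℕ
  K = toℕ ∘ pos
  K-injective : Injective _≡_ _≡_ K
  K-injective = pos-injective ∘ Finₚ.toℕ-injective

nearᵇ : ℕ → Bool
nearᵇ 1 = true
nearᵇ 2 = true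
nearᵇ _ = false

PathSquare : ∀ n → Graph n
PathSquare n = record
  { adj    = λ i j → nearᵇ ∣ toℕ i - toℕ j ∣
  ; sym    = λ i j → cong nearᵇ (∣-∣-comm (toℕ i) (toℕ j))
  ; irrefl = λ i → cong nearᵇ (∣n-n∣≡0 (toℕ i))
  }

data Near : ℕ → ℕ → Set where
  up₁   : ∀ {a} → Near a (suc a)
  up₂   : ∀ {a} → Near a (suc (suc a))
  down₁ : ∀ {a} → Near (suc a) a
  down₂ : ∀ {a} → Near (suc (suc a)) a

Near-suc : ∀ {a b} → Near a b → Near (suc a) (suc b)
Near-suc up₁   = up₁
Near-suc up₂   = up₂
Near-suc down₁ = down₁
Near-suc down₂ = down₂

near-view : ∀ a b → nearᵇ ∣ a - b ∣ ≡ true → Near a b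
near-view zero                zero                ()
near-view zero                (suc zero)          _ = up₁
near-view zero                (suc (suc zero))    _ = up₂
near-view zero                (suc (suc (suc b))) ()
near-view (suc zero)          zero                _ = down₁
near-view (suc (suc zero))    zero                _ = down₂
near-view (suc (suc (suc a))) zero                ()
near-view (suc a)             (suc b)             e = Near-suc (near-view a b e)

Near-triangle : ∀ {a b} → Near a b → ∃ λ c → Near a c × Near b c
Near-triangle up₁   = _ , up₂ , up₁
Near-triangle up₂   = _ , up₁ , down₁
Near-triangle down₁ = _ , up₁ , up₂
Near-triangle down₂ = _ , down₁ , up₁

direction : ∀ {a b} → Near a b → Fin 4
direction up₁   = zero
direction up₂   = suc zero
direction down₁ = suc (suc zero)
direction down₂ = suc (suc (suc zero))

neighbour : ℕ → Fin 4 → ℕ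
neighbour a zero                = suc a
neighbour a (suc zero)          = suc (suc a)
neighbour a (suc (suc zero))    = a ∸ 1
neighbour a (suc (suc (suc _))) = a ∸ 2

Near⇒≡neighbour : ∀ {a b} (a~b : Near a b) → b ≡ neighbour a (direction a~b)
Near⇒≡neighbour up₁   = refl
Near⇒≡neighbour up₂   = refl
Near⇒≡neighbour down₁ = refl
Near⇒≡neighbour down₂ = refl

Near-direction-injective : ∀ {a b c} (a~b : Near a b) (a~c : Near a c) → direction a~b ≡ direction a~c → b ≡ c
Near-direction-injective a~b a~c same =
  trans (Near⇒≡neighbour a~b) (trans (cong (neighbour _) same) (sym (Near⇒≡neighbour a~c)))

Near-five-neighbours : ∀ {v} {g : Fin 5 → ℕ} → (∀ t → Near v (g t)) → ∃₂ λ s t → s Fin.< t × g s ≡ g t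
Near-five-neighbours v~g with s , t , s<t , same ← Finₚ.pigeonhole (n<1+n 4) (direction ∘ v~g) =
  s , t , s<t , Near-direction-injective (v~g s) (v~g t) same

Near-fifth-neighbour : ∀ {v w} {u : Fin 4 → ℕ} → Injective _≡_ _≡_ u →
                       Near v w → (∀ s → Near v (u s)) → ∃ λ s → w ≡ u s
Near-fifth-neighbour {w = w} {u} u-injective v~w v~u
  with Near-five-neighbours {g = w ∷ u} (λ { zero → v~w ; (suc s) → v~u s })
... | zero  , suc s , _   , w≡us  = s , w≡us
... | suc s , suc t , s<t , us≡ut = contradiction (cong (toℕ ∘ suc) (u-injective us≡ut)) (<⇒≢ s<t)

module _ {p q : ℕ} where

  x y : Fin (2 + p + q)
  x = zero
  y = suc zero

  xNbr : Fin (suc p) → Fin (2 + p + q)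
  xNbr s = suc s ↑ˡ q

  yNbr : Fin (suc q) → Fin (2 + p + q)
  yNbr zero    = x
  yNbr (suc t) = (2 + p) ↑ʳ t

  x~xNbr : ∀ s → adj (DoubleStar p q) x (xNbr s) ≡ true
  x~xNbr s = subst (λ k → dsAdj p 0 (suc k) ≡ true) (sym (Finₚ.toℕ-↑ˡ s q)) (x~ (toℕ s) (Finₚ.toℕ≤pred[n] s))
    where
    x~ : ∀ k → k ≤ p → dsAdj p 0 (suc k) ≡ true
    x~ zero    _   = refl
    x~ (suc k) k<p = ∨-true _ (∨-true false (<ᵇ-true k<p))

  y~yNbr : ∀ t → adj (DoubleStar p q) y (yNbr t) ≡ true
  y~yNbr zero    = refl
  y~yNbr (suc t) = subst (λ k → dsAdj p 1 k ≡ true) (sym (Finₚ.toℕ-↑ʳ (2 + p) t))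
    (∨-true _ (≤ᵇ-true (m≤m+n (2 + p) (toℕ t))))

  xNbr-injective : Injective _≡_ _≡_ xNbr
  xNbr-injective eq = Finₚ.suc-injective (Finₚ.↑ˡ-injective q _ _ eq)

  yNbr-injective : Injective _≡_ _≡_ yNbr
  yNbr-injective {zero}  {zero}  _  = refl
  yNbr-injective {suc t} {suc u} eq = cong suc (Finₚ.↑ʳ-injective (2 + p) t u eq)

  xNbr≢yNbr : ∀ s t → xNbr s ≢ yNbr t
  xNbr≢yNbr s zero    ()
  xNbr≢yNbr s (suc t) eq with () ← trans (sym (Finₚ.splitAt-↑ˡ (2 + p) (suc s) q))
                                    (trans (cong (splitAt (2 + p)) eq) (Finₚ.splitAt-↑ʳ (2 + p) q t))

  DoubleStar-⊄-Near : 3 ≤ p × 3 ≤ q ⊎ 4 ≤ q →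
                      (φ : Fin (2 + p + q) → ℕ) → Injective _≡_ _≡_ φ →
                      (∀ i j → adj (DoubleStar p q) i j ≡ true → Near (φ i) (φ j)) → ⊥
  DoubleStar-⊄-Near (inj₁ (3≤p , 3≤q)) φ φ-injective φ-hom
    with c , x~c , y~c ← Near-triangle (φ-hom x y (x~xNbr zero))
    with s , c≡xs ← Near-fifth-neighbour {u = φ ∘ xNbr ∘ (λ s → inject≤ s (s≤s 3≤p))}
                      (λ eq → Finₚ.inject≤-injective _ _ _ _ (xNbr-injective (φ-injective eq)))
                      x~c (λ s → φ-hom x _ (x~xNbr (inject≤ s (s≤s 3≤p))))
    with t , c≡yt ← Near-fifth-neighbour {u = φ ∘ yNbr ∘ (λ t → inject≤ t (s≤s 3≤q))}
                      (λ eq → Finₚ.inject≤-injective _ _ _ _ (yNbr-injective (φ-injective eq)))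
                      y~c (λ t → φ-hom y _ (y~yNbr (inject≤ t (s≤s 3≤q))))
    = xNbr≢yNbr (inject≤ s (s≤s 3≤p)) (inject≤ t (s≤s 3≤q)) (φ-injective (trans (sym c≡xs) c≡yt))
  DoubleStar-⊄-Near (inj₂ 4≤q) φ φ-injective φ-hom
    with s , x≡ys ← Near-fifth-neighbour {u = φ ∘ yNbr ∘ suc ∘ (λ s → inject≤ s 4≤q)}
                      (λ eq → Finₚ.inject≤-injective _ _ _ _ (Finₚ.suc-injective (yNbr-injective (φ-injective eq))))
                      (φ-hom y x (y~yNbr zero)) (λ s → φ-hom y _ (y~yNbr (suc (inject≤ s 4≤q))))
    = Finₚ.0≢1+n (yNbr-injective (φ-injective x≡ys))

PathSquare-free : ∀ {p q} → 3 ≤ p × 3 ≤ q ⊎ 4 ≤ q → ∀ n → (PathSquare n -free) (DoubleStar p q)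
PathSquare-free star n (f , f-injective , f-hom) =
  DoubleStar-⊄-Near star (toℕ ∘ f) (f-injective ∘ Finₚ.toℕ-injective) (λ i j ij → near-view _ _ (f-hom i j ij))

forward-degree : ∀ a n → ∑[ j < n ] 𝟙 ((a <ᵇ toℕ j) ∧ nearᵇ ∣ a - toℕ j ∣) ≡ 𝟙 (suc a <ᵇ n) + 𝟙 (2 + a <ᵇ n)
forward-degree zero    zero                = refl
forward-degree zero    (suc zero)          = refl
forward-degree zero    (suc (suc zero))    = refl
forward-degree zero    (suc (suc (suc n))) = cong (2 +_) (sum-replicate-zero n)
forward-degree (suc a) zero                = refl
forward-degree (suc a) (suc n)             = forward-degree a n

∑-𝟙-<ᵇ : ∀ n k → ∑[ i < n ] 𝟙 (toℕ i <ᵇ k) ≡ n ⊓ k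
∑-𝟙-<ᵇ zero    k       = refl
∑-𝟙-<ᵇ (suc n) zero    = sum-replicate-zero n
∑-𝟙-<ᵇ (suc n) (suc k) = cong suc (∑-𝟙-<ᵇ n k)

PathSquare-edgeCount : ∀ {n} → 2 ≤ n → edgeCount (PathSquare n) ≡ 2 * n ∸ 3
PathSquare-edgeCount {suc (suc m)} (s≤s (s≤s _)) = begin
  edgeCount (PathSquare n)                                      ≡⟨ edgeCount≡forwardEdgeCount (PathSquare n) ⟩
  forwardEdgeCount (PathSquare n) toℕ                           ≡⟨ sum-cong-≗ {n} (λ i → forward-degree (toℕ i) n) ⟩
  ∑[ i < n ] (𝟙 (toℕ i <ᵇ suc m) + 𝟙 (toℕ i <ᵇ m))             ≡⟨ ∑-distrib-+ {n} (λ i → 𝟙 (toℕ i <ᵇ suc m)) (λ i → 𝟙 (toℕ i <ᵇ m)) ⟩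
  ∑[ i < n ] 𝟙 (toℕ i <ᵇ suc m) + ∑[ i < n ] 𝟙 (toℕ i <ᵇ m)   ≡⟨ cong₂ _+_ (∑-𝟙-<ᵇ n (suc m)) (∑-𝟙-<ᵇ n m) ⟩
  n ⊓ suc m + n ⊓ m                                             ≡⟨ cong₂ _+_ (m≥n⇒m⊓n≡n (n≤1+n (suc m))) (m≥n⇒m⊓n≡n (m≤n+m m 2)) ⟩
  suc m + m                                                     ≡⟨ +-comm (suc m) m ⟩
  m + suc m                                                     ≡⟨ 2[2+m]∸3≡m+[1+m] m ⟨
  2 * n ∸ 3                                                     ∎
  where
  open ≡-Reasoning
  n : ℕ
  n = suc (suc m)

isEven : ℕ → Bool
isEven zero          = true
isEven (suc zero)    = false
isEven (suc (suc k)) = isEven k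

isEven-suc : ∀ k → isEven (suc k) ≡ not (isEven k)
isEven-suc zero          = refl
isEven-suc (suc zero)    = refl
isEven-suc (suc (suc k)) = isEven-suc k

even⇒⌊k/2⌋+⌊k/2⌋≡k : ∀ k → isEven k ≡ true → ⌊ k /2⌋ + ⌊ k /2⌋ ≡ k
even⇒⌊k/2⌋+⌊k/2⌋≡k zero          _    = refl
even⇒⌊k/2⌋+⌊k/2⌋≡k (suc (suc k)) even = cong suc (trans (+-suc ⌊ k /2⌋ ⌊ k /2⌋) (cong suc (even⇒⌊k/2⌋+⌊k/2⌋≡k k even)))

odd⇒1+⌊k/2⌋+⌊k/2⌋≡k : ∀ k → isEven k ≡ false → suc (⌊ k /2⌋ + ⌊ k /2⌋) ≡ k
odd⇒1+⌊k/2⌋+⌊k/2⌋≡k (suc zero)    _   = refl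
odd⇒1+⌊k/2⌋+⌊k/2⌋≡k (suc (suc k)) odd = cong suc (trans (cong suc (+-suc ⌊ k /2⌋ ⌊ k /2⌋)) (cong suc (odd⇒1+⌊k/2⌋+⌊k/2⌋≡k k odd)))

even⇒⌈k/2⌉≡⌊k/2⌋ : ∀ k → isEven k ≡ true → ⌈ k /2⌉ ≡ ⌊ k /2⌋
even⇒⌈k/2⌉≡⌊k/2⌋ zero          _    = refl
even⇒⌈k/2⌉≡⌊k/2⌋ (suc (suc k)) even = cong suc (even⇒⌈k/2⌉≡⌊k/2⌋ k even)

-- The vertices 0, 2, 4, … run along the circle from position 0 upwards and 1, 3, 5, … from
-- position C downwards.  Then k ~ k + 2 join neighbouring positions, and the rungs k ~ k + 1
-- join ⌈k/2⌉ to C ∸ ⌊k/2⌋, which are nested intervals.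
module Zigzag (C : ℕ) where

  zigzag : ℕ → ℕ
  zigzag k = if isEven k then ⌊ k /2⌋ else C ∸ ⌊ k /2⌋

  zigzag-even : ∀ {k} → isEven k ≡ true → zigzag k ≡ ⌊ k /2⌋
  zigzag-even {k} even = cong (λ b → if b then ⌊ k /2⌋ else C ∸ ⌊ k /2⌋) even

  zigzag-odd : ∀ {k} → isEven k ≡ false → zigzag k ≡ C ∸ ⌊ k /2⌋
  zigzag-odd {k} odd = cong (λ b → if b then ⌊ k /2⌋ else C ∸ ⌊ k /2⌋) odd

  zigzag≤C : ∀ {k} → k ≤ C → zigzag k ≤ C
  zigzag≤C {k} k≤C with isEven k
  ... | true  = ≤-trans (⌊n/2⌋≤n k) k≤C
  ... | false = m∸n≤m C ⌊ k /2⌋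

  even-odd-apart : ∀ {a b} → a ≤ C → b ≤ C → isEven a ≡ true → isEven b ≡ false → ⌊ a /2⌋ ≢ C ∸ ⌊ b /2⌋
  even-odd-apart {a} {b} a≤C b≤C even odd eq = 1+n≰n (subst (_≤ C + C) a+b≡1+2C (+-mono-≤ a≤C b≤C))
    where
    open ≡-Reasoning
    u v : ℕ
    u = ⌊ a /2⌋
    v = ⌊ b /2⌋
    u+v≡C : u + v ≡ C
    u+v≡C = trans (cong (_+ v) eq) (m∸n+n≡m (≤-trans (⌊n/2⌋≤n b) b≤C))
    a+b≡1+2C : a + b ≡ suc (C + C)
    a+b≡1+2C = begin
      a + b                   ≡⟨ cong₂ _+_ (even⇒⌊k/2⌋+⌊k/2⌋≡k a even) (odd⇒1+⌊k/2⌋+⌊k/2⌋≡k b odd) ⟨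
      (u + u) + suc (v + v)   ≡⟨ +-suc (u + u) (v + v) ⟩
      suc ((u + u) + (v + v)) ≡⟨ cong suc (interchange u u v v) ⟩
      suc ((u + v) + (u + v)) ≡⟨ cong (λ t → suc (t + t)) u+v≡C ⟩
      suc (C + C)             ∎

  zigzag-injective : ∀ {a b} → a ≤ C → b ≤ C → zigzag a ≡ zigzag b → a ≡ b
  zigzag-injective {a} {b} a≤C b≤C eq with isEven a in ea | isEven b in eb
  ... | true  | true  = begin
    a                          ≡⟨ even⇒⌊k/2⌋+⌊k/2⌋≡k a ea ⟨
    ⌊ a /2⌋ + ⌊ a /2⌋          ≡⟨ cong (λ t → t + t) eq ⟩
    ⌊ b /2⌋ + ⌊ b /2⌋          ≡⟨ even⇒⌊k/2⌋+⌊k/2⌋≡k b eb ⟩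
    b                          ∎
    where open ≡-Reasoning
  ... | false | false = begin
    a                          ≡⟨ odd⇒1+⌊k/2⌋+⌊k/2⌋≡k a ea ⟨
    suc (⌊ a /2⌋ + ⌊ a /2⌋)    ≡⟨ cong (λ t → suc (t + t)) (∸-cancelˡ-≡ (half≤C a≤C) (half≤C b≤C) eq) ⟩
    suc (⌊ b /2⌋ + ⌊ b /2⌋)    ≡⟨ odd⇒1+⌊k/2⌋+⌊k/2⌋≡k b eb ⟩
    b                          ∎
    where
    open ≡-Reasoning
    half≤C : ∀ {k} → k ≤ C → ⌊ k /2⌋ ≤ C
    half≤C {k} = ≤-trans (⌊n/2⌋≤n k)
  ... | true  | false = contradiction eq (even-odd-apart a≤C b≤C ea eb)
  ... | false | true  = contradiction (sym eq) (even-odd-apart b≤C a≤C eb ea)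

  Adjacent : ℕ → ℕ → Set
  Adjacent x y = y ≡ suc x ⊎ x ≡ suc y

  Rung : ℕ → ℕ → ℕ → Set
  Rung k x y = (x ≡ ⌈ k /2⌉ × y ≡ C ∸ ⌊ k /2⌋) ⊎ (x ≡ C ∸ ⌊ k /2⌋ × y ≡ ⌈ k /2⌉)

  Chord : ℕ → ℕ → Set
  Chord x y = Adjacent x y ⊎ ∃ λ k → k ≤ C × Rung k x y

  Chord-sym : ∀ {x y} → Chord x y → Chord y x
  Chord-sym (inj₁ (inj₁ eq))                 = inj₁ (inj₂ eq)
  Chord-sym (inj₁ (inj₂ eq))                 = inj₁ (inj₁ eq)
  Chord-sym (inj₂ (k , k≤C , inj₁ (ex , ey))) = inj₂ (k , k≤C , inj₂ (ey , ex))
  Chord-sym (inj₂ (k , k≤C , inj₂ (ex , ey))) = inj₂ (k , k≤C , inj₁ (ey , ex))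

  rung : ∀ k → Rung k (zigzag k) (zigzag (suc k))
  rung k with isEven k in e
  ... | true  = inj₁ (sym (even⇒⌈k/2⌉≡⌊k/2⌋ k e) ,
                      trans (zigzag-odd {suc k} (trans (isEven-suc k) (cong not e))) (cong (C ∸_) (even⇒⌈k/2⌉≡⌊k/2⌋ k e)))
  ... | false = inj₂ (refl , zigzag-even {suc k} (trans (isEven-suc k) (cong not e)))

  skip : ∀ k → 2 + k ≤ C → Adjacent (zigzag k) (zigzag (2 + k))
  skip k 2+k≤C with isEven k
  ... | true  = inj₁ refl
  ... | false = inj₂ (+-∸-assoc 1 (≤-trans (s≤s (⌊n/2⌋≤n k)) (≤-trans (n≤1+n (suc k)) 2+k≤C)))

  Near⇒Chord : ∀ {a b} → a ≤ C → b ≤ C → Near a b → Chord (zigzag a) (zigzag b)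
  Near⇒Chord {a} a≤C _   up₁   = inj₂ (a , a≤C , rung a)
  Near⇒Chord {a} _   b≤C up₂   = inj₁ (skip a b≤C)
  Near⇒Chord {_} {b} _ b≤C down₁ = Chord-sym (inj₂ (b , b≤C , rung b))
  Near⇒Chord {_} {b} a≤C _ down₂ = Chord-sym (inj₁ (skip b a≤C))

  ⌈k/2⌉≤C∸⌊k/2⌋ : ∀ {k} → k ≤ C → ⌈ k /2⌉ ≤ C ∸ ⌊ k /2⌋
  ⌈k/2⌉≤C∸⌊k/2⌋ {k} k≤C = m+n≤o⇒m≤o∸n ⌈ k /2⌉ (subst (_≤ C) (sym (trans (+-comm ⌈ k /2⌉ ⌊ k /2⌋) (⌊n/2⌋+⌈n/2⌉≡n k))) k≤C)

  Rung-ordered : ∀ {k x y} → k ≤ C → Rung k x y → x < y → x ≡ ⌈ k /2⌉ × y ≡ C ∸ ⌊ k /2⌋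
  Rung-ordered _   (inj₁ ends)     _   = ends
  Rung-ordered k≤C (inj₂ (ex , ey)) x<y = contradiction (subst₂ _≤_ (sym ey) (sym ex) (⌈k/2⌉≤C∸⌊k/2⌋ k≤C)) (<⇒≱ x<y)

  chords-noncrossing : ∀ {x₁ y₁ x₂ y₂} → Chord x₁ y₁ → Chord x₂ y₂ → ¬ (x₁ < x₂ × x₂ < y₁ × y₁ < y₂)
  chords-noncrossing (inj₁ (inj₁ refl)) _ (x₁<x₂ , x₂<y₁ , _) = <⇒≱ x₂<y₁ x₁<x₂
  chords-noncrossing (inj₁ (inj₂ refl)) _ (x₁<x₂ , x₂<y₁ , _) = <⇒≱ (<-trans x₁<x₂ x₂<y₁) (n≤1+n _)
  chords-noncrossing (inj₂ _) (inj₁ (inj₁ refl)) (_ , x₂<y₁ , y₁<y₂) = <⇒≱ y₁<y₂ x₂<y₁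
  chords-noncrossing (inj₂ _) (inj₁ (inj₂ refl)) (_ , x₂<y₁ , y₁<y₂) = <⇒≱ (<-trans x₂<y₁ y₁<y₂) (n≤1+n _)
  chords-noncrossing (inj₂ (k , k≤C , r)) (inj₂ (l , l≤C , s)) (x₁<x₂ , x₂<y₁ , y₁<y₂)
    with refl , refl ← Rung-ordered k≤C r (<-trans x₁<x₂ x₂<y₁)
    with refl , refl ← Rung-ordered l≤C s (<-trans x₂<y₁ y₁<y₂)
    = <⇒≱ y₁<y₂ (∸-monoʳ-≤ C (⌊n/2⌋-mono (<⇒≤ k<l)))
    where
    k<l : k < l
    k<l = ≰⇒> (λ l≤k → <⇒≱ x₁<x₂ (⌈n/2⌉-mono l≤k))

PathSquare-outerplanar : ∀ n → Outerplanar (PathSquare n)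
PathSquare-outerplanar zero    = id , id , λ ()
PathSquare-outerplanar (suc C) = pos , pos-injective , noncrossing
  where
  open Zigzag C
  ≤C : (i : Fin (suc C)) → toℕ i ≤ C
  ≤C = Finₚ.toℕ≤pred[n]
  pos : Fin (suc C) → Fin (suc C)
  pos i = fromℕ< (s≤s (zigzag≤C (≤C i)))
  toℕ-pos : ∀ i → toℕ (pos i) ≡ zigzag (toℕ i)
  toℕ-pos i = Finₚ.toℕ-fromℕ< (s≤s (zigzag≤C (≤C i)))
  pos-injective : Injective _≡_ _≡_ pos
  pos-injective {i} {j} eq = Finₚ.toℕ-injective
    (zigzag-injective (≤C i) (≤C j) (trans (sym (toℕ-pos i)) (trans (cong toℕ eq) (toℕ-pos j))))
  chord : ∀ {i j} → adj (PathSquare (suc C)) i j ≡ true → Chord (toℕ (pos i)) (toℕ (pos j))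
  chord {i} {j} ij rewrite toℕ-pos i | toℕ-pos j = Near⇒Chord (≤C i) (≤C j) (near-view _ _ ij)
  noncrossing : ∀ a b c d → adj (PathSquare (suc C)) a b ≡ true → adj (PathSquare (suc C)) c d ≡ true →
                ¬ (pos a Fin.< pos c × pos c Fin.< pos b × pos b Fin.< pos d)
  noncrossing a b c d ab cd = chords-noncrossing (chord {a} {b} ab) (chord {c} {d} cd)

theorem4 : (p q n : ℕ) → 2 ≤ p → p ≤ q → p + q + 2 ≤ n → (3 ≤ p ⊎ 4 ≤ q) →
    ((G : Graph n) → Outerplanar G → (G -free) (DoubleStar p q) → edgeCount G ≤ 2 * n ∸ 3)
    × Σ (Graph n) (λ G → Outerplanar G × (G -free) (DoubleStar p q) × edgeCount G ≡ 2 * n ∸ 3)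
theorem4 p q n _ p≤q p+q+2≤n 3≤p⊎4≤q =
    (λ G G-outerplanar _ → outerplanar-edgeCount≤ 2≤n G G-outerplanar)
  , PathSquare n , PathSquare-outerplanar n , PathSquare-free star n , PathSquare-edgeCount 2≤n
  where
  2≤n : 2 ≤ n
  2≤n = ≤-trans (m≤n+m 2 (p + q)) p+q+2≤n
  star : 3 ≤ p × 3 ≤ q ⊎ 4 ≤ q
  star = map₁ (λ 3≤p → 3≤p , ≤-trans 3≤p p≤q) 3≤p⊎4≤q
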